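{- Let $G=(V,E)$ be a finite directed graph. For every passage $P$ of $G$ there is a set $\{P_1,\dots,P_n\}$ of non-empty minimal passages of $G$ such that $\bigcup_{i=1}^n P_i=P$ and $P_i\cap P_j=\emptyset$ for all $1\le i<j\le n$.
   Context: A directed graph is a pair $G=(V,E)$ with $E\subseteq V\times V$; finite means $V$ is finite. A set $P\subseteq E$ is a passage of $G$ if for every $(x,y)\in P$ and all $x',y'\in V$ with $(x,y')\in E$ and $(x',y)\in E$, we have $(x,y')\in P$ and $(x',y)\in P$. A passage $P$ is minimal if there is no non-empty passage $P'$ of $G$ with $P'\subsetneq P$. -}

module Defs where

open import Data.Nat using (ℕ)
open import Data.Fin using (Fin; _<_)
open import Data.Bool using (Bool; true)
open import Data.Product using (_×_; ∃₂; ∃)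
open import Relation.Binary.PropositionalEquality using (_≡_)
open import Relation.Nullary using (¬_)
open import Function.Bundles using (_⇔_)

-- A finite directed graph on vertex set Fin k is given by its (decidable)
-- edge relation; a set of edges is a Boolean-valued relation on Fin k.
EdgeSet : ℕ → Set
EdgeSet k = Fin k → Fin k → Bool

_∋_,_ : ∀ {k} → EdgeSet k → Fin k → Fin k → Set
S ∋ x , y = S x y ≡ true

infix 4 _∋_,_ _⊆_ _⊊_

_⊆_ : ∀ {k} → EdgeSet k → EdgeSet k → Set
A ⊆ B = ∀ x y → A ∋ x , y → B ∋ x , y

_⊊_ : ∀ {k} → EdgeSet k → EdgeSet k → Set
A ⊊ B = A ⊆ B × ¬ (B ⊆ A)

NonEmpty : ∀ {k} → EdgeSet k → Set
NonEmpty S = ∃₂ λ x y → S ∋ x , y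

IsPassage : ∀ {k} → (E P : EdgeSet k) → Set
IsPassage E P =
  P ⊆ E ×
  (∀ x y x' y' → P ∋ x , y → E ∋ x , y' → E ∋ x' , y →
     (P ∋ x , y') × (P ∋ x' , y))

IsMinimalPassage : ∀ {k} → (E P : EdgeSet k) → Set
IsMinimalPassage E P =
  IsPassage E P × (∀ P' → IsPassage E P' → NonEmpty P' → ¬ (P' ⊊ P))

module Submission where

-- Passages are closed under difference, so E ∖ Q is a passage whenever Q is.
-- For an edge e of G, saturating {e} (repeatedly adding every edge of G that
-- shares a tail or a head with an edge already present) terminates, because
-- strict inclusion of edge sets is well founded, and produces the least
-- passage containing e.  A least passage containing one of its edges is
-- minimal: a non-empty passage P' strictly inside it either contains e, and
-- then everything, or avoids e, and then E ∖ P' contains e and hence all of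
-- the least passage, including the edges of P'.
-- The theorem follows by well-founded induction on P: split off the least
-- passage C generated by any edge of P and decompose the smaller passage
-- P ∖ C.

open import Defs
open import Data.Nat using (ℕ; suc; _*_; s≤s)
open import Data.Fin using (Fin; zero; suc; _<_; remQuot; combine)
open import Data.Fin.Properties using (any?; remQuot-combine) renaming (_≟_ to _≟ᶠ_)
open import Data.Fin.Subset as Subset using (Subset)
open import Data.Fin.Subset.Induction as SubsetInduction using ()
open import Data.Vec using (lookup; tabulate)
open import Data.Vec.Properties using (lookup∘tabulate; []=⇒lookup; lookup⇒[]=)
open import Data.Bool using (true; _≟_)
open import Data.Bool.Properties using (T-≡)
open import Data.Product using (_×_; _,_; ∃; ∃₂; Σ; proj₁; proj₂; uncurry)
open import Data.Sum using (_⊎_; inj₁; inj₂)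
open import Data.Empty using (⊥-elim)
open import Function using (flip)
open import Function.Bundles using (_⇔_; mk⇔; Equivalence)
open import Induction.WellFounded using (WellFounded; Acc; acc; module Subrelation)
import Relation.Binary.Construct.On as On
open import Relation.Nullary using (¬_; Dec; yes; no)
open import Relation.Nullary.Decidable using (isYes; toSum; decidable-stable; toWitness; fromWitness; _×-dec_; _⊎-dec_; ¬?)
open import Relation.Binary.PropositionalEquality using (_≡_; refl; sym; trans; cong)

module _ {k : ℕ} where

  _∋?_,_ : (S : EdgeSet k) (x y : Fin k) → Dec (S ∋ x , y)
  S ∋? x , y = S x y ≟ true

  ⟦_⟧ : {R : Fin k → Fin k → Set} → (∀ x y → Dec (R x y)) → EdgeSet k
  ⟦ R? ⟧ x y = isYes (R? x y)

  ∋⟦⟧ : {R : Fin k → Fin k → Set} (R? : ∀ x y → Dec (R x y)) {x y : Fin k} →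
        (⟦ R? ⟧ ∋ x , y) ⇔ R x y
  ∋⟦⟧ R? = mk⇔ (λ h → toWitness (Equivalence.from T-≡ h))
               (λ r → Equivalence.to T-≡ (fromWitness r))

  infix 4 _⊂_

  _⊂_ : EdgeSet k → EdgeSet k → Set
  A ⊂ B = A ⊆ B × ∃₂ λ x y → B ∋ x , y × ¬ (A ∋ x , y)

  flatten : EdgeSet k → Subset (k * k)
  flatten S = tabulate (λ i → uncurry S (remQuot k i))

  lookup-flatten : ∀ S x y → lookup (flatten S) (combine x y) ≡ S x y
  lookup-flatten S x y =
    trans (lookup∘tabulate _ (combine x y)) (cong (uncurry S) (remQuot-combine x y))

  flatten-⊆ : ∀ {A B} → A ⊆ B → flatten A Subset.⊆ flatten B
  flatten-⊆ A⊆B {i} i∈A = lookup⇒[]= i _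
    (trans (lookup∘tabulate _ i)
       (A⊆B _ _ (trans (sym (lookup∘tabulate _ i)) ([]=⇒lookup i∈A))))

  flatten-⊂ : ∀ {A B} → A ⊂ B → flatten A Subset.⊂ flatten B
  flatten-⊂ {A} {B} (A⊆B , x , y , xy∈B , xy∉A) =
    flatten-⊆ A⊆B , combine x y ,
    lookup⇒[]= _ _ (trans (lookup-flatten B x y) xy∈B) ,
    λ xy∈A → xy∉A (trans (sym (lookup-flatten A x y)) ([]=⇒lookup xy∈A))

  ⊂-wellFounded : WellFounded _⊂_
  ⊂-wellFounded = Subrelation.wellFounded flatten-⊂
    (On.wellFounded flatten SubsetInduction.⊂-wellFounded)

  ⊃-wellFounded : WellFounded (flip _⊂_)
  ⊃-wellFounded = Subrelation.wellFounded flatten-⊂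
    (On.wellFounded flatten SubsetInduction.⊃-wellFounded)

  ⊆-or-counterexample : (A B : EdgeSet k) →
                        A ⊆ B ⊎ (∃₂ λ x y → A ∋ x , y × ¬ (B ∋ x , y))
  ⊆-or-counterexample A B
    with any? (λ x → any? (λ y → (A ∋? x , y) ×-dec ¬? (B ∋? x , y)))
  ... | yes (x , y , xy∈A , xy∉B) = inj₂ (x , y , xy∈A , xy∉B)
  ... | no none = inj₁ λ x y xy∈A →
          decidable-stable (B ∋? x , y) (λ xy∉B → none (x , y , xy∈A , xy∉B))

  nonEmpty-or-empty : (S : EdgeSet k) → NonEmpty S ⊎ (∀ x y → ¬ (S ∋ x , y))
  nonEmpty-or-empty S with any? (λ x → any? (λ y → S ∋? x , y))
  ... | yes (x , y , xy∈S) = inj₁ (x , y , xy∈S)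
  ... | no none = inj₂ λ x y xy∈S → none (x , y , xy∈S)

  -- Saturation: iterating an inflationary operator f that preserves an
  -- invariant reaches an f-stable set satisfying the invariant, since every
  -- non-stable step strictly enlarges the set.
  saturate : (f : EdgeSet k → EdgeSet k) (Inv : EdgeSet k → Set) →
             (∀ S → S ⊆ f S) → (∀ {S} → Inv S → Inv (f S)) →
             ∀ S → Inv S → ∃ λ C → Inv C × f C ⊆ C
  saturate f Inv inflationary preserves S₀ inv₀ = iterate S₀ inv₀ (⊃-wellFounded S₀)
    where
    iterate : ∀ S → Inv S → Acc (flip _⊂_) S → ∃ λ C → Inv C × f C ⊆ C
    iterate S inv (acc larger) with ⊆-or-counterexample (f S) S
    ... | inj₁ stable = S , inv , stable
    ... | inj₂ (x , y , xy∈fS , xy∉S) =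
          iterate (f S) (preserves inv) (larger (inflationary S , x , y , xy∈fS , xy∉S))

  in-difference? : (A B : EdgeSet k) → ∀ x y → Dec (A ∋ x , y × ¬ (B ∋ x , y))
  in-difference? A B x y = (A ∋? x , y) ×-dec ¬? (B ∋? x , y)

  _∖_ : EdgeSet k → EdgeSet k → EdgeSet k
  A ∖ B = ⟦ in-difference? A B ⟧

  ∋∖ : ∀ A B {x y} → (A ∖ B ∋ x , y) ⇔ (A ∋ x , y × ¬ (B ∋ x , y))
  ∋∖ A B = ∋⟦⟧ (in-difference? A B)

module Passages {k : ℕ} (E : EdgeSet k) where

  open Equivalence using (to; from)

  tail-closed : ∀ {Q x y y'} → IsPassage E Q → Q ∋ x , y → E ∋ x , y' → Q ∋ x , y'
  tail-closed (Q⊆E , closed) xy∈Q xy'∈E = proj₁ (closed _ _ _ _ xy∈Q xy'∈E (Q⊆E _ _ xy∈Q))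

  head-closed : ∀ {Q x y x'} → IsPassage E Q → Q ∋ x , y → E ∋ x' , y → Q ∋ x' , y
  head-closed (Q⊆E , closed) xy∈Q x'y∈E = proj₂ (closed _ _ _ _ xy∈Q (Q⊆E _ _ xy∈Q) x'y∈E)

  E-passage : IsPassage E E
  E-passage = (λ _ _ xy∈E → xy∈E) , λ _ _ _ _ _ xy'∈E x'y∈E → xy'∈E , x'y∈E

  -- Passages are closed under difference: an edge adjacent to an edge
  -- outside B is itself outside B, since B is closed.
  ∖-passage : ∀ {A B} → IsPassage E A → IsPassage E B → IsPassage E (A ∖ B)
  ∖-passage {A} {B} A-passage B-passage =
    (λ x y xy∈A∖B → proj₁ A-passage x y (proj₁ (to (∋∖ A B) xy∈A∖B))) ,
    λ x y x' y' xy∈A∖B xy'∈E x'y∈E →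
      let (xy∈A , xy∉B) = to (∋∖ A B) xy∈A∖B in
      from (∋∖ A B) (tail-closed A-passage xy∈A xy'∈E ,
               λ xy'∈B → xy∉B (tail-closed B-passage xy'∈B (proj₁ A-passage x y xy∈A))) ,
      from (∋∖ A B) (head-closed A-passage xy∈A x'y∈E ,
               λ x'y∈B → xy∉B (head-closed B-passage x'y∈B (proj₁ A-passage x y xy∈A)))

  Adjacent : EdgeSet k → Fin k → Fin k → Set
  Adjacent S x y = (∃ λ y' → S ∋ x , y') ⊎ (∃ λ x' → S ∋ x' , y)

  in-extension? : (S : EdgeSet k) → ∀ x y → Dec (S ∋ x , y ⊎ (E ∋ x , y × Adjacent S x y))
  in-extension? S x y = (S ∋? x , y) ⊎-dec ((E ∋? x , y) ×-dec
    (any? (λ y' → S ∋? x , y') ⊎-dec any? (λ x' → S ∋? x' , y)))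

  extend : EdgeSet k → EdgeSet k
  extend S = ⟦ in-extension? S ⟧

  ⊆-extend : ∀ S → S ⊆ extend S
  ⊆-extend S x y xy∈S = from (∋⟦⟧ (in-extension? S)) (inj₁ xy∈S)

  extend-least : ∀ {S Q} → IsPassage E Q → S ⊆ Q → extend S ⊆ Q
  extend-least {S} Q-passage S⊆Q x y xy∈extS with to (∋⟦⟧ (in-extension? S)) xy∈extS
  ... | inj₁ xy∈S = S⊆Q x y xy∈S
  ... | inj₂ (xy∈E , inj₁ (y' , xy'∈S)) = tail-closed Q-passage (S⊆Q x y' xy'∈S) xy∈E
  ... | inj₂ (xy∈E , inj₂ (x' , x'y∈S)) = head-closed Q-passage (S⊆Q x' y x'y∈S) xy∈E

  stable⇒passage : ∀ {S} → S ⊆ E → extend S ⊆ S → IsPassage E S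
  stable⇒passage {S} S⊆E stable = S⊆E , λ x y x' y' xy∈S xy'∈E x'y∈E →
    stable x y' (from (∋⟦⟧ (in-extension? S)) (inj₂ (xy'∈E , inj₁ (y , xy∈S)))) ,
    stable x' y (from (∋⟦⟧ (in-extension? S)) (inj₂ (x'y∈E , inj₂ (x , xy∈S))))

  IsLeastPassageAt : Fin k → Fin k → EdgeSet k → Set
  IsLeastPassageAt a b C =
    IsPassage E C × C ∋ a , b × (∀ Q → IsPassage E Q → Q ∋ a , b → C ⊆ Q)

  -- Every edge (a , b) of G generates a least passage: saturate {(a , b)}
  -- under extension, keeping the invariant that the set contains (a , b)
  -- and lies inside every passage containing (a , b).
  leastPassage : ∀ a b → E ∋ a , b → ∃ (IsLeastPassageAt a b)
  leastPassage a b ab∈E = C , stable⇒passage (below-all E E-passage ab∈E) stable , ab∈C , below-all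
    where
    BelowPassagesAt : EdgeSet k → Set
    BelowPassagesAt S = S ∋ a , b × (∀ Q → IsPassage E Q → Q ∋ a , b → S ⊆ Q)

    is-ab? : ∀ x y → Dec (x ≡ a × y ≡ b)
    is-ab? x y = (x ≟ᶠ a) ×-dec (y ≟ᶠ b)

    singleton-below : BelowPassagesAt ⟦ is-ab? ⟧
    singleton-below = from (∋⟦⟧ is-ab?) (refl , refl) , λ Q _ ab∈Q x y xy∈singleton →
      case-ab (to (∋⟦⟧ is-ab?) xy∈singleton) ab∈Q
      where
      case-ab : ∀ {Q x y} → x ≡ a × y ≡ b → Q ∋ a , b → Q ∋ x , y
      case-ab (refl , refl) ab∈Q = ab∈Q

    extend-below : ∀ {S} → BelowPassagesAt S → BelowPassagesAt (extend S)
    extend-below {S} (ab∈S , below) = ⊆-extend S a b ab∈S ,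
      λ Q Q-passage ab∈Q → extend-least Q-passage (below Q Q-passage ab∈Q)

    saturated : ∃ λ C → BelowPassagesAt C × extend C ⊆ C
    saturated = saturate extend BelowPassagesAt ⊆-extend extend-below ⟦ is-ab? ⟧ singleton-below

    C : EdgeSet k
    C = proj₁ saturated

    ab∈C : C ∋ a , b
    ab∈C = proj₁ (proj₁ (proj₂ saturated))

    below-all : ∀ Q → IsPassage E Q → Q ∋ a , b → C ⊆ Q
    below-all = proj₂ (proj₁ (proj₂ saturated))

    stable : extend C ⊆ C
    stable = proj₂ (proj₂ saturated)

  -- A non-empty passage P' inside C
  -- contains (a , b), and then all of C; otherwise E ∖ P' is a passage
  -- containing (a , b), hence containing C and so the edges of P'.
  least⇒minimal : ∀ {a b C} → IsLeastPassageAt a b C → IsMinimalPassage E C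
  least⇒minimal {a} {b} {C} (C-passage , ab∈C , below-all) = C-passage , no-smaller
    where
    no-smaller : ∀ P' → IsPassage E P' → NonEmpty P' → ¬ (P' ⊊ C)
    no-smaller P' P'-passage (p , q , pq∈P') (P'⊆C , C⊈P') with P' ∋? a , b
    ... | yes ab∈P' = C⊈P' (below-all P' P'-passage ab∈P')
    ... | no ab∉P' = proj₂ (to (∋∖ E P') (C⊆E∖P' p q (P'⊆C p q pq∈P'))) pq∈P'
      where
      C⊆E∖P' : C ⊆ E ∖ P'
      C⊆E∖P' = below-all (E ∖ P') (∖-passage E-passage P'-passage)
                 (from (∋∖ E P') (proj₁ C-passage a b ab∈C , ab∉P'))

  Decomposition : EdgeSet k → Set
  Decomposition P = ∃ λ (n : ℕ) → Σ (Fin n → EdgeSet k) λ Ps →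
    (∀ i → NonEmpty (Ps i) × IsMinimalPassage E (Ps i)) ×
    (∀ x y → (P ∋ x , y) ⇔ (∃ λ i → Ps i ∋ x , y)) ×
    (∀ i j → i < j → ∀ x y → ¬ ((Ps i ∋ x , y) × (Ps j ∋ x , y)))

  empty-decomposition : ∀ {P} → (∀ x y → ¬ (P ∋ x , y)) → Decomposition P
  empty-decomposition P-empty = 0 , (λ ()) , (λ ()) ,
    (λ x y → mk⇔ (λ xy∈P → ⊥-elim (P-empty x y xy∈P)) (λ { (() , _) })) , (λ ())

  cons-decomposition : ∀ {P C R} → NonEmpty C → IsMinimalPassage E C →
    (∀ x y → (P ∋ x , y) ⇔ (C ∋ x , y ⊎ R ∋ x , y)) →
    (∀ x y → C ∋ x , y → ¬ (R ∋ x , y)) →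
    Decomposition R → Decomposition P
  cons-decomposition {P} {C} {R} C-nonEmpty C-minimal P≡C∪R C∩R≡∅
                     (n , Rs , Rs-minimal , R≡⋃Rs , Rs-disjoint) =
    suc n , Ps , Ps-minimal , P≡⋃Ps , Ps-disjoint
    where
    Ps : Fin (suc n) → EdgeSet k
    Ps zero = C
    Ps (suc i) = Rs i

    Ps-minimal : ∀ i → NonEmpty (Ps i) × IsMinimalPassage E (Ps i)
    Ps-minimal zero = C-nonEmpty , C-minimal
    Ps-minimal (suc i) = Rs-minimal i

    P⊆⋃Ps : ∀ x y → P ∋ x , y → ∃ λ i → Ps i ∋ x , y
    P⊆⋃Ps x y xy∈P with to (P≡C∪R x y) xy∈P
    ... | inj₁ xy∈C = zero , xy∈C
    ... | inj₂ xy∈R with to (R≡⋃Rs x y) xy∈R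
    ...   | i , xy∈Rsᵢ = suc i , xy∈Rsᵢ

    ⋃Ps⊆P : ∀ x y → (∃ λ i → Ps i ∋ x , y) → P ∋ x , y
    ⋃Ps⊆P x y (zero , xy∈C) = from (P≡C∪R x y) (inj₁ xy∈C)
    ⋃Ps⊆P x y (suc i , xy∈Rsᵢ) = from (P≡C∪R x y) (inj₂ (from (R≡⋃Rs x y) (i , xy∈Rsᵢ)))

    P≡⋃Ps : ∀ x y → (P ∋ x , y) ⇔ (∃ λ i → Ps i ∋ x , y)
    P≡⋃Ps x y = mk⇔ (P⊆⋃Ps x y) (⋃Ps⊆P x y)

    Ps-disjoint : ∀ i j → i < j → ∀ x y → ¬ ((Ps i ∋ x , y) × (Ps j ∋ x , y))
    Ps-disjoint zero (suc j) _ x y (xy∈C , xy∈Rsⱼ) =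
      C∩R≡∅ x y xy∈C (from (R≡⋃Rs x y) (j , xy∈Rsⱼ))
    Ps-disjoint (suc i) (suc j) (s≤s i<j) = Rs-disjoint i j i<j

  split-∖ : ∀ {P C : EdgeSet k} → C ⊆ P → ∀ x y → (P ∋ x , y) ⇔ (C ∋ x , y ⊎ (P ∖ C) ∋ x , y)
  split-∖ {P} {C} C⊆P x y = mk⇔ split join
    where
    split : P ∋ x , y → C ∋ x , y ⊎ (P ∖ C) ∋ x , y
    split xy∈P with toSum (C ∋? x , y)
    ... | inj₁ xy∈C = inj₁ xy∈C
    ... | inj₂ xy∉C = inj₂ (from (∋∖ P C) (xy∈P , xy∉C))

    join : C ∋ x , y ⊎ (P ∖ C) ∋ x , y → P ∋ x , y
    join (inj₁ xy∈C) = C⊆P x y xy∈C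
    join (inj₂ xy∈P∖C) = proj₁ (to (∋∖ P C) xy∈P∖C)

  decompose : ∀ P → IsPassage E P → Acc _⊂_ P → Decomposition P
  decompose P P-passage (acc smaller) with nonEmpty-or-empty P
  ... | inj₂ P-empty = empty-decomposition P-empty
  ... | inj₁ (a , b , ab∈P) = split-off (leastPassage a b (proj₁ P-passage a b ab∈P))
    where
    split-off : ∃ (IsLeastPassageAt a b) → Decomposition P
    split-off (C , C-least@(C-passage , ab∈C , below-all)) =
      cons-decomposition (a , b , ab∈C) (least⇒minimal C-least)
        (split-∖ (below-all P P-passage ab∈P))
        (λ x y xy∈C xy∈P∖C → proj₂ (to (∋∖ P C) xy∈P∖C) xy∈C)
        (decompose (P ∖ C) (∖-passage P-passage C-passage) (smaller P∖C⊂P))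
      where
      P∖C⊂P : P ∖ C ⊂ P
      P∖C⊂P = (λ x y xy∈P∖C → proj₁ (to (∋∖ P C) xy∈P∖C)) ,
              a , b , ab∈P , λ ab∈P∖C → proj₂ (to (∋∖ P C) ab∈P∖C) ab∈C

mainTheorem7 : (k : ℕ) (E P : EdgeSet k) → IsPassage E P →
    ∃ λ (n : ℕ) → Σ (Fin n → EdgeSet k) λ Ps →
    (∀ i → NonEmpty (Ps i) × IsMinimalPassage E (Ps i)) ×
    (∀ x y → (P ∋ x , y) ⇔ (∃ λ i → Ps i ∋ x , y)) ×
    (∀ i j → i < j → ∀ x y → ¬ ((Ps i ∋ x , y) × (Ps j ∋ x , y)))
mainTheorem7 k E P P-passage = decompose P P-passage (⊂-wellFounded P)
  where open Passages E
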